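{- Let $M(n)=n^7+3n^6+2n^4+4n^3+n+1$. There exists $N_0\in\mathbb{N}$ such that for every graph $G$ of order $n\geq N_0$ and vertices $a,b$ of $G$, the following are equivalent: (i) $G$ has a Hamiltonian path from $a$ to $b$; (ii) the graph $G^{a,b}$ has an orientation $D$ with $W(D)\geq M(n)$.
   Context: Graphs are finite and simple. A Hamiltonian path is a path containing all vertices. For a graph $G$ of order $n$ with vertices $a,b$, $G^{a,b}$ is the graph obtained from $G$ by adding $2n^3+2$ new vertices $a_0,a_1,\ldots,a_{n^3}$ and $b_0,b_1,\ldots,b_{n^3}$ together with the edges $aa_0$, $bb_0$, and $a_0a_i$, $b_0b_i$ for $i=1,\ldots,n^3$. For a digraph $D$ with vertex set $V$, $d_D(u,v)$ is the length of a shortest directed $(u,v)$-path if one exists and $0$ otherwise, and $W(D)=\sum_{(u,v)\in V\times V} d_D(u,v)$. -}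

module Defs where

open import Data.Nat using (ℕ; zero; suc; _+_; _*_; _^_; _≤_)
open import Data.Fin using (Fin; zero; suc; _≟_)
open import Data.Bool using (Bool; true; false; _∧_)
open import Data.List using (List; []; _∷_; map; _++_; concatMap)
open import Data.Nat.ListAction using (sum)
open import Data.List.Membership.Propositional using (_∈_)
open import Data.List.Relation.Unary.Unique.Propositional using (Unique)
open import Data.Product using (Σ; ∃; ∃-syntax; _×_)
open import Data.Sum using (_⊎_)
open import Relation.Nullary using (¬_)
open import Relation.Nullary.Decidable using (⌊_⌋)
open import Relation.Binary.PropositionalEquality using (_≡_)
open import Data.List using () renaming (allFin to allFinL)

record Graph (n : ℕ) : Set where
  field
    adj    : Fin n → Fin n → Bool
    sym    : ∀ u v → adj u v ≡ adj v u
    irrefl : ∀ u → adj u u ≡ false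

open Graph public

data HWalk {n : ℕ} (G : Graph n) : Fin n → List (Fin n) → Fin n → Set where
  single : ∀ a → HWalk G a (a ∷ []) a
  cons   : ∀ {a x xs b} → adj G a x ≡ true → HWalk G x xs b → HWalk G a (a ∷ xs) b

HamPath : {n : ℕ} → Graph n → Fin n → Fin n → Set
HamPath {n} G a b =
  Σ (List (Fin n)) λ xs → HWalk G a xs b × Unique xs × (∀ v → v ∈ xs)

record FinGraph : Set₁ where
  field
    V     : Set
    verts : List V          -- the vertex set, each vertex exactly once
    edge  : V → V → Bool

open FinGraph public

-- Vertex type of G^{a,b}: old vertices, a_0..a_{n^3}, b_0..b_{n^3}
data ExtV (n : ℕ) : Set where
  old : Fin n → ExtV n
  aV  : Fin (suc (n ^ 3)) → ExtV n
  bV  : Fin (suc (n ^ 3)) → ExtV n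

extEdge : {n : ℕ} → Graph n → Fin n → Fin n → ExtV n → ExtV n → Bool
extEdge G a b (old u)      (old v)      = adj G u v
extEdge G a b (old u)      (aV zero)    = ⌊ u ≟ a ⌋
extEdge G a b (aV zero)    (old u)      = ⌊ u ≟ a ⌋
extEdge G a b (old u)      (bV zero)    = ⌊ u ≟ b ⌋
extEdge G a b (bV zero)    (old u)      = ⌊ u ≟ b ⌋
extEdge G a b (aV zero)    (aV (suc _)) = true
extEdge G a b (aV (suc _)) (aV zero)    = true
extEdge G a b (bV zero)    (bV (suc _)) = true
extEdge G a b (bV (suc _)) (bV zero)    = true
extEdge G a b _            _            = false

ext : {n : ℕ} → Graph n → Fin n → Fin n → FinGraph
ext {n} G a b = record
  { V     = ExtV n
  ; verts = map old (allFinL n) ++ map aV (allFinL (suc (n ^ 3)))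
                                ++ map bV (allFinL (suc (n ^ 3)))
  ; edge  = extEdge G a b
  }

record Orientation (H : FinGraph) : Set where
  field
    arc     : V H → V H → Bool
    arc⊆    : ∀ u v → arc u v ≡ true → edge H u v ≡ true
    total   : ∀ u v → edge H u v ≡ true → (arc u v ≡ true) ⊎ (arc v u ≡ true)
    antisym : ∀ u v → arc u v ≡ true → arc v u ≡ false

open Orientation public

data DWalk {H : FinGraph} (D : Orientation H) : V H → V H → ℕ → Set where
  nil  : ∀ u → DWalk D u u 0
  step : ∀ {u w v k} → arc D u w ≡ true → DWalk D w v k → DWalk D u v (suc k)

-- d is the distance d_D(u,v): length of a shortest directed (u,v)-path
-- (= shortest directed walk) if one exists, and 0 otherwise.
IsDist : {H : FinGraph} → Orientation H → V H → V H → ℕ → Set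
IsDist D u v d =
  (DWalk D u v d × (∀ k → DWalk D u v k → d ≤ k))
  ⊎ ((¬ (∃[ k ] DWalk D u v k)) × d ≡ 0)

IsWiener : {H : FinGraph} → Orientation H → ℕ → Set
IsWiener {H} D w =
  Σ (V H → V H → ℕ) λ d →
    (∀ u v → IsDist D u v (d u v)) ×
    w ≡ sum (concatMap (λ u → map (λ v → d u v) (verts H)) (verts H))

M : ℕ → ℕ
M n = n ^ 7 + 3 * n ^ 6 + 2 * n ^ 4 + 4 * n ^ 3 + n + 1

-- Given a Hamiltonian (a, b)-path, orient G^{a,b} so that the path aᵢ a₀ a … b b₀ bⱼ
-- is directed and every other edge of G points backwards along it by at least two steps. The
-- distance to the end of that path then drops by at most one per arc, so it bounds distances from
-- below, and the rows of a₀ and of the aᵢ alone already give W(D) ≥ M(n).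
-- Conversely, in any orientation every distance is at most n + 3: the inner vertices of a path are
-- distinct and are not leaves. A leaf-to-leaf distance n + 3 between the two sides is realised by a
-- path that runs through all of G, i.e. a Hamiltonian path (reverse the orientation for paths from
-- b to a). Otherwise a leaf row only counts the other leaves when the leaf points to its hub, and
-- with the rearrangement inequality for the numbers of in- and out-pointing leaves W(D) < M(n)
-- follows for n ≥ 8.
module Submission where

open import Defs
open import Data.Bool using (Bool; true; false; _∧_)
open import Data.Bool.Properties using (∧-conicalˡ; ∧-conicalʳ; ∧-zeroʳ)
open import Data.Fin using (Fin; zero; suc; _≟_)
open import Data.Fin.Properties using (any?)
open import Data.List using (List; []; _∷_; _++_; _∷ʳ_; length; map; concatMap; reverse; allFin)
open import Data.List.Properties using (map-++; map-∘; map-cong; map-tabulate; length-map; length-tabulate; length-++; length-removeAt′; unfold-reverse)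
open import Data.List.Membership.Propositional using (_∈_; _∉_; lose)
open import Data.List.Membership.Propositional.Properties using (∈-map⁺; ∈-++⁺ˡ; ∈-++⁺ʳ; ∈-allFin)
open import Data.List.Relation.Binary.Permutation.Propositional using (↭-sym; ↭⇒↭ₛ)
open import Data.List.Relation.Binary.Permutation.Propositional.Properties using (↭-reverse)
open import Data.List.Relation.Binary.Subset.Propositional using (_⊆_)
open import Data.List.Relation.Unary.All as All using (All; []; _∷_)
open import Data.List.Relation.Unary.All.Properties using (¬Any⇒All¬; ++⁻ˡ)
open import Data.List.Relation.Unary.Any as Any using (Any; here; there; _─_; index; satisfied)
open import Data.List.Relation.Unary.AllPairs using ([]; _∷_)
open import Data.List.Relation.Unary.Unique.Propositional using (Unique)
open import Data.List.Relation.Unary.Unique.Propositional.Properties using (allFin⁺; map⁻)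
open import Data.Nat using (ℕ; zero; suc; _+_; _*_; _^_; _≤_; _<_; z≤n; s≤s; _≤?_; _<?_)
open import Data.Nat.ListAction using (sum)
open import Data.Nat.ListAction.Properties using (sum-++)
open import Data.Nat.Properties renaming (_≟_ to _≟ℕ_)
open import Data.Product using (Σ; ∃; ∃-syntax; _×_; _,_; proj₁; proj₂)
open import Data.Sum using (_⊎_; inj₁; inj₂; [_,_]′)
open import Function using (_∘_; id)
open import Function.Bundles using (_⇔_; mk⇔)
open import Relation.Binary.Definitions using (DecidableEquality; Decidable; tri<; tri≈; tri>)
open import Relation.Binary.PropositionalEquality as ≡ using (_≡_; _≢_; refl; trans; cong; cong₂; subst; subst₂)
open import Relation.Nullary using (¬_; Dec; yes; no; does; contradiction)
open import Relation.Unary using () renaming (Decidable to Decidable₁)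
open import Relation.Nullary.Decidable as Dec using (_×-dec_; _⊎-dec_; dec-true; dec-false; ⌊_⌋; isYes≗does)
open import Data.Nat.Tactic.RingSolver using (solve-∀)
open import Data.Nat.Solver using (module +-*-Solver)
open +-*-Solver using (solve; _:=_; _:+_; _:*_; _:^_; con)

module _ {A : Set} where

  ∈-─ : ∀ {x z : A} {ys} (x∈ys : x ∈ ys) → z ∈ ys → z ≢ x → z ∈ (ys ─ x∈ys)
  ∈-─ (here refl) (here refl)  z≢x = contradiction refl z≢x
  ∈-─ (here refl) (there z∈ys) _   = z∈ys
  ∈-─ (there _)   (here refl)  _   = here refl
  ∈-─ (there x∈ys) (there z∈ys) z≢x = there (∈-─ x∈ys z∈ys z≢x)

  unique⊆⇒length≤ : ∀ {xs ys : List A} → Unique xs → xs ⊆ ys → length xs ≤ length ys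
  unique⊆⇒length≤ {[]}     _              _     = z≤n
  unique⊆⇒length≤ {x ∷ xs} {ys} (x∉xs ∷ uxs) xs⊆ys = begin
    suc (length xs)          ≤⟨ s≤s (unique⊆⇒length≤ uxs xs⊆ys─x) ⟩
    suc (length (ys ─ x∈ys)) ≡⟨ length-removeAt′ ys (index x∈ys) ⟨
    length ys                ∎
    where
    open ≤-Reasoning
    x∈ys = xs⊆ys (here refl)
    xs⊆ys─x : xs ⊆ (ys ─ x∈ys)
    xs⊆ys─x z∈xs = ∈-─ x∈ys (xs⊆ys (there z∈xs)) λ { refl → All.lookup x∉xs z∈xs refl }

  unique-++⁻ˡ : ∀ xs {ys : List A} → Unique (xs ++ ys) → Unique xs
  unique-++⁻ˡ []       _            = []
  unique-++⁻ˡ (x ∷ xs) (x∉ ∷ uxys) = ++⁻ˡ xs x∉ ∷ unique-++⁻ˡ xs uxys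

  unique-reverse : ∀ {xs : List A} → Unique xs → Unique (reverse xs)
  unique-reverse {xs} = Unique-resp-↭ (↭⇒↭ₛ (↭-sym (↭-reverse xs)))
    where open import Data.List.Relation.Binary.Permutation.Setoid.Properties (≡.setoid A) using (Unique-resp-↭)

  module _ (_≟ᴬ_ : DecidableEquality A) where

    open import Data.List.Membership.DecPropositional _≟ᴬ_ using (_∈?_)

    unique-length⇒⊇ : ∀ {xs ys : List A} → Unique xs → xs ⊆ ys → length ys ≤ length xs → ys ⊆ xs
    unique-length⇒⊇ {xs} {ys} uxs xs⊆ys |ys|≤|xs| {v} v∈ys with v ∈? xs
    ... | yes v∈xs = v∈xs
    ... | no  v∉xs = contradiction |ys|≤|xs| (<⇒≱ (unique⊆⇒length≤ (¬Any⇒All¬ xs v∉xs ∷ uxs) v∷xs⊆ys))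
      where
      v∷xs⊆ys : v ∷ xs ⊆ ys
      v∷xs⊆ys (here refl)  = v∈ys
      v∷xs⊆ys (there z∈xs) = xs⊆ys z∈xs

    after : A → List A → ℕ
    after v []       = 0
    after v (x ∷ xs) with v ≟ᴬ x
    ... | yes _ = length xs
    ... | no  _ = after v xs

    after-here : ∀ x xs → after x (x ∷ xs) ≡ length xs
    after-here x xs with x ≟ᴬ x
    ... | yes _   = refl
    ... | no  x≢x = contradiction refl x≢x

    after-there : ∀ {v x} xs → v ≢ x → after v (x ∷ xs) ≡ after v xs
    after-there {v} {x} xs v≢x with v ≟ᴬ x
    ... | yes v≡x = contradiction v≡x v≢x
    ... | no  _   = refl

    after-< : ∀ {v xs} → v ∈ xs → after v xs < length xs
    after-< {v} {x ∷ xs} v∈ with v ≟ᴬ x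
    ... | yes _   = ≤-refl
    ... | no  v≢x = m<n⇒m<1+n (after-< (Any.tail v≢x v∈))

    after-injective : ∀ {u v xs} → u ∈ xs → v ∈ xs → after u xs ≡ after v xs → u ≡ v
    after-injective {u} {v} {x ∷ xs} u∈ v∈ eq with u ≟ᴬ x | v ≟ᴬ x
    ... | yes refl | yes refl = refl
    ... | yes _    | no  v≢x = contradiction (≡.sym eq) (<⇒≢ (after-< (Any.tail v≢x v∈)))
    ... | no  u≢x  | yes _   = contradiction eq (<⇒≢ (after-< (Any.tail u≢x u∈)))
    ... | no  u≢x  | no  v≢x = after-injective (Any.tail u≢x u∈) (Any.tail v≢x v∈) eq

module _ {A : Set} where

  sum-concatMap : ∀ (f : A → List ℕ) xs → sum (concatMap f xs) ≡ sum (map (sum ∘ f) xs)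
  sum-concatMap f []       = refl
  sum-concatMap f (x ∷ xs) = trans (sum-++ (f x) (concatMap f xs)) (cong (sum (f x) +_) (sum-concatMap f xs))

  sum-map-++ : ∀ (f : A → ℕ) xs ys → sum (map f (xs ++ ys)) ≡ sum (map f xs) + sum (map f ys)
  sum-map-++ f xs ys = trans (cong sum (map-++ f xs ys)) (sum-++ (map f xs) (map f ys))

  sum-map-mono : ∀ {f g : A → ℕ} → (∀ x → f x ≤ g x) → ∀ xs → sum (map f xs) ≤ sum (map g xs)
  sum-map-mono f≤g []       = z≤n
  sum-map-mono f≤g (x ∷ xs) = +-mono-≤ (f≤g x) (sum-map-mono f≤g xs)

  sum-map-const : ∀ c (xs : List A) → sum (map (λ _ → c) xs) ≡ length xs * c
  sum-map-const c []       = refl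
  sum-map-const c (x ∷ xs) = cong (c +_) (sum-map-const c xs)

  sum-map-+ : ∀ (f g : A → ℕ) xs → sum (map (λ x → f x + g x) xs) ≡ sum (map f xs) + sum (map g xs)
  sum-map-+ f g []       = refl
  sum-map-+ f g (x ∷ xs) = trans (cong (f x + g x +_) (sum-map-+ f g xs)) (+-assoc-comm (f x) (g x) _ _)
    where
    +-assoc-comm : ∀ p q r s → p + q + (r + s) ≡ p + r + (q + s)
    +-assoc-comm = solve-∀

  sum-map-*ˡ : ∀ c (f : A → ℕ) xs → sum (map (λ x → c * f x) xs) ≡ c * sum (map f xs)
  sum-map-*ˡ c f []       = ≡.sym (*-zeroʳ c)
  sum-map-*ˡ c f (x ∷ xs) = trans (cong (c * f x +_) (sum-map-*ˡ c f xs)) (≡.sym (*-distribˡ-+ c (f x) _))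

module _ {A : Set} where

  map-allFin-suc : ∀ {k} (f : Fin (suc k) → A) → map f (allFin (suc k)) ≡ f zero ∷ map (f ∘ suc) (allFin k)
  map-allFin-suc f = cong (f zero ∷_) (trans (map-tabulate suc f) (≡.sym (map-tabulate id (f ∘ suc))))

length-allFin : ∀ k → length (allFin k) ≡ k
length-allFin k = length-tabulate id

const≤sum-allFin : ∀ {k c} {f : Fin k → ℕ} → (∀ i → c ≤ f i) → k * c ≤ sum (map f (allFin k))
const≤sum-allFin {k} {c} c≤f = subst (_≤ _) (trans (sum-map-const c (allFin k)) (cong (_* c) (length-allFin k))) (sum-map-mono c≤f (allFin k))

sum-map-map : ∀ {A B : Set} (g : B → ℕ) (f : A → B) xs → sum (map g (map f xs)) ≡ sum (map (g ∘ f) xs)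
sum-map-map g f xs = cong sum (≡.sym (map-∘ xs))

sum-allFin≤const : ∀ {k c} {f : Fin k → ℕ} → (∀ i → f i ≤ c) → sum (map f (allFin k)) ≤ k * c
sum-allFin≤const {k} {c} f≤c = subst (_ ≤_) (trans (sum-map-const c (allFin k)) (cong (_* c) (length-allFin k))) (sum-map-mono f≤c (allFin k))

sum-allFin≤affine : ∀ {k K Z} {f c : Fin k → ℕ} → (∀ i → f i ≤ K + Z * c i) →
                    sum (map f (allFin k)) ≤ k * K + Z * sum (map c (allFin k))
sum-allFin≤affine {k} {K} {Z} {f} {c} f≤ = begin
  sum (map f (allFin k))                                                ≤⟨ sum-map-mono f≤ (allFin k) ⟩
  sum (map (λ i → K + Z * c i) (allFin k))                              ≡⟨ sum-map-+ (λ _ → K) (λ i → Z * c i) (allFin k) ⟩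
  sum (map (λ _ → K) (allFin k)) + sum (map (λ i → Z * c i) (allFin k)) ≡⟨ cong₂ _+_ K-part (sum-map-*ˡ Z c (allFin k)) ⟩
  k * K + Z * sum (map c (allFin k))                                    ∎
  where
  open ≤-Reasoning
  K-part = trans (sum-map-const K (allFin k)) (cong (_* K) (length-allFin k))

least-below : ∀ {P : ℕ → Set} → Decidable₁ P → ∀ B →
              (∃ λ k → k < B × P k × (∀ {j} → j < k → ¬ P j)) ⊎ (∀ {j} → j < B → ¬ P j)
least-below P? zero = inj₂ λ ()
least-below P? (suc B) with least-below P? B
... | inj₁ (k , k<B , Pk , below) = inj₁ (k , m<n⇒m<1+n k<B , Pk , below)
... | inj₂ none with P? B
...   | yes PB  = inj₁ (B , ≤-refl , PB , none)
...   | no  ¬PB = inj₂ λ j<1+B → [ none , (λ { refl → ¬PB }) ]′ (m≤n⇒m<n∨m≡n (≤-pred j<1+B))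

private
  rearrangement-≥ : ∀ x x′ y y′ → y′ ≤ x → x + x′ ≡ y + y′ → x * x′ + y * y′ ≤ x * y + x′ * y′
  rearrangement-≥ x x′ y y′ y′≤x eq with t , refl ← m≤n⇒∃[o]m+o≡n y′≤x
    with refl ← +-cancelˡ-≡ y′ y (t + x′) (trans (+-comm y′ y) (trans (≡.sym eq) (+-assoc y′ t x′)))
    = ≤-trans (m≤m+n _ (t * t)) (≤-reflexive (gap y′ t x′))
    where
    gap : ∀ y′ t x′ → (y′ + t) * x′ + (t + x′) * y′ + t * t ≡ (y′ + t) * (t + x′) + x′ * y′
    gap = solve-∀

-- For x + x′ = y + y′ the difference of the two sides is (x − y′)².
rearrangement : ∀ x x′ y y′ → x + x′ ≡ y + y′ → x * x′ + y * y′ ≤ x * y + x′ * y′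
rearrangement x x′ y y′ eq with ≤-total y′ x
... | inj₁ y′≤x = rearrangement-≥ x x′ y y′ y′≤x eq
... | inj₂ x≤y′ = subst₂ _≤_ (swapped x x′ y y′) (swapped x y x′ y′)
                    (rearrangement-≥ y′ y x′ x x≤y′ (trans (+-comm y′ y) (trans (≡.sym eq) (+-comm x x′))))
  where
  swapped : ∀ p q r s → s * r + q * p ≡ p * q + r * s
  swapped = solve-∀

-- Leaf-to-leaf distances: x, y leaves point to their hubs a₀, b₀ and x′, y′ leaves away from them.
leaf-pairs≤ : ∀ n x x′ y y′ → x + x′ ≡ y + y′ →
              (2 * x′ + (2 + n) * y′) * x + ((2 + n) * x′ + 2 * y′) * y ≤ (2 + n) * ((x + x′) * (y + y′))
leaf-pairs≤ n x x′ y y′ eq = begin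
  (2 * x′ + (2 + n) * y′) * x + ((2 + n) * x′ + 2 * y′) * y    ≡⟨ split n x x′ y y′ ⟩
  2 * (x * x′ + y * y′) + (2 + n) * (x * y′ + y * x′)           ≤⟨ +-monoˡ-≤ _ (*-mono-≤ (m≤m+n 2 n) (rearrangement x x′ y y′ eq)) ⟩
  (2 + n) * (x * y + x′ * y′) + (2 + n) * (x * y′ + y * x′)     ≡⟨ join n x x′ y y′ ⟩
  (2 + n) * ((x + x′) * (y + y′))                              ∎
  where
  open ≤-Reasoning
  split : ∀ n x x′ y y′ → (2 * x′ + (2 + n) * y′) * x + ((2 + n) * x′ + 2 * y′) * y ≡ 2 * (x * x′ + y * y′) + (2 + n) * (x * y′ + y * x′)
  split = solve-∀
  join : ∀ n x x′ y y′ → (2 + n) * (x * y + x′ * y′) + (2 + n) * (x * y′ + y * x′) ≡ (2 + n) * ((x + x′) * (y + y′))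
  join = solve-∀

RankStep : ℕ → ℕ → Set
RankStep p q = p ≡ suc q ⊎ suc p < q

RankStep? : Decidable RankStep
RankStep? p q = (p ≟ℕ suc q) ⊎-dec (suc p <? q)

RankStep-asym : ∀ {p q} → RankStep p q → ¬ RankStep q p
RankStep-asym (inj₁ refl) (inj₁ q≡2+q) = m+1+n≢n 1 (≡.sym q≡2+q)
RankStep-asym (inj₁ refl) (inj₂ lt)    = <-irrefl refl lt
RankStep-asym (inj₂ lt)   (inj₁ refl)  = <-irrefl refl lt
RankStep-asym (inj₂ lt)   (inj₂ lt′)   = <-asym (<-trans (n<1+n _) lt) (<-trans (n<1+n _) lt′)

RankStep-connex : ∀ {p q} → p ≢ q → RankStep p q ⊎ RankStep q p
RankStep-connex {p} {q} p≢q with <-cmp p q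
... | tri< p<q _ _ = [ inj₁ ∘ inj₂ , (λ 1+p≡q → inj₂ (inj₁ (≡.sym 1+p≡q))) ]′ (m≤n⇒m<n∨m≡n p<q)
... | tri≈ _ p≡q _ = contradiction p≡q p≢q
... | tri> _ _ q<p = [ inj₂ ∘ inj₂ , (λ 1+q≡p → inj₁ (inj₁ (≡.sym 1+q≡p))) ]′ (m≤n⇒m<n∨m≡n q<p)

RankStep⇒≤suc : ∀ {p q} → RankStep p q → p ≤ suc q
RankStep⇒≤suc (inj₁ refl) = ≤-refl
RankStep⇒≤suc (inj₂ lt)   = ≤-trans (n≤1+n _) (≤-trans (<⇒≤ lt) (n≤1+n _))

𝟙 : Bool → ℕ
𝟙 true  = 1
𝟙 false = 0

record Pendant (H : FinGraph) (ℓ h : V H) : Set where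
  field
    from : ∀ {u} → edge H ℓ u ≡ true → u ≡ h
    to   : ∀ {u} → edge H u ℓ ≡ true → u ≡ h

module Walks {H : FinGraph} (D : Orientation H) where

  vertices : ∀ {u v k} → DWalk D u v k → List (V H)
  vertices (nil u)        = u ∷ []
  vertices (step {u} _ w) = u ∷ vertices w

  length-vertices : ∀ {u v k} (w : DWalk D u v k) → length (vertices w) ≡ suc k
  length-vertices (nil _)    = refl
  length-vertices (step _ w) = cong suc (length-vertices w)

  head∈ : ∀ {u v k} (w : DWalk D u v k) → u ∈ vertices w
  head∈ (nil _)    = here refl
  head∈ (step _ _) = here refl

  Path : V H → V H → ℕ → Set
  Path u v k = Σ (DWalk D u v k) (Unique ∘ vertices)

  snoc : ∀ {u v w k} → DWalk D u v k → arc D v w ≡ true → DWalk D u w (suc k)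
  snoc (nil _)     e = step e (nil _)
  snoc (step e′ p) e = step e′ (snoc p e)

  vertices-snoc : ∀ {u v w k} (p : DWalk D u v k) (e : arc D v w ≡ true) → vertices (snoc p e) ≡ vertices p ∷ʳ w
  vertices-snoc (nil _)     e = refl
  vertices-snoc (step _ p)  e = cong (_ ∷_) (vertices-snoc p e)

  _⇝_ : V H → V H → Set
  u ⇝ v = ∃ (DWalk D u v)

  _◅_ : ∀ {u v w} → arc D u v ≡ true → v ⇝ w → u ⇝ w
  e ◅ (k , p) = suc k , step e p

  _▻_ : ∀ {u v w} → u ⇝ v → arc D v w ≡ true → u ⇝ w
  (k , p) ▻ e = suc k , snoc p e

  infixr 4 _◅_
  infixl 5 _▻_

  inner : ∀ {u v k} → DWalk D u v k → List (V H)
  inner (nil _)        = []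
  inner (step {u} _ w) = u ∷ inner w

  vertices≡inner∷ʳ : ∀ {u v k} (w : DWalk D u v k) → vertices w ≡ inner w ∷ʳ v
  vertices≡inner∷ʳ (nil _)    = refl
  vertices≡inner∷ʳ (step _ w) = cong (_ ∷_) (vertices≡inner∷ʳ w)

  length-inner : ∀ {u v k} (w : DWalk D u v k) → length (inner w) ≡ k
  length-inner (nil _)    = refl
  length-inner (step _ w) = cong suc (length-inner w)

  unique-inner : ∀ {u v k} (w : DWalk D u v k) → Unique (vertices w) → Unique (inner w)
  unique-inner w uw = unique-++⁻ˡ (inner w) (subst Unique (vertices≡inner∷ʳ w) uw)

  pendant-not-inner : ∀ {ℓ h p u v k} → Pendant H ℓ h → arc D p u ≡ true → (w : DWalk D u v k) →
                      Unique (p ∷ vertices w) → ℓ ∉ inner w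
  pendant-not-inner ℓ-pendant e (step e′ w) (p∉ ∷ _) (here refl) =
    All.lookup p∉ (there (head∈ w)) (trans (Pendant.to ℓ-pendant (arc⊆ D _ _ e)) (≡.sym (Pendant.from ℓ-pendant (arc⊆ D _ _ e′))))
  pendant-not-inner ℓ-pendant e (step e′ w) (_ ∷ uw) (there ℓ∈) = pendant-not-inner ℓ-pendant e′ w uw ℓ∈

  dist≤length : ∀ {u v d k} → IsDist D u v d → DWalk D u v k → d ≤ k
  dist≤length (inj₁ (_ , shortest)) w = shortest _ w
  dist≤length (inj₂ (_ , refl))     _ = z≤n

  dist-walk : ∀ {u v d} → IsDist D u v d → u ⇝ v → DWalk D u v d
  dist-walk (inj₁ (w , _))           _ = w
  dist-walk (inj₂ (unreachable , _)) r = contradiction r unreachable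

  dist-from-source : ∀ {u v d} → (∀ z → arc D u z ≡ false) → IsDist D u v d → d ≡ 0
  dist-from-source _    (inj₁ (nil _ , _))                 = refl
  dist-from-source none (inj₁ (step {w = z} e _ , _))      = contradiction (trans (≡.sym e) (none z)) λ ()
  dist-from-source _    (inj₂ (_ , d≡0))                   = d≡0

  no-walk-into-sink : ∀ {u v k} → (∀ z → arc D z v ≡ false) → ¬ DWalk D u v (suc k)
  no-walk-into-sink none (step {u} e (nil _))  = contradiction (trans (≡.sym e) (none u)) λ ()
  no-walk-into-sink none (step _ (step e′ w)) = no-walk-into-sink none (step e′ w)

  dist-to-sink : ∀ {u v d} → (∀ z → arc D z v ≡ false) → IsDist D u v d → d ≡ 0
  dist-to-sink _    (inj₁ (nil _ , _))      = refl
  dist-to-sink none (inj₁ (step e w , _))   = contradiction (step e w) (no-walk-into-sink none)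
  dist-to-sink _    (inj₂ (_ , d≡0))        = d≡0

  dist-from-pendant : ∀ {ℓ h v d} → Pendant H ℓ h → arc D ℓ h ≡ false → IsDist D ℓ v d → d ≡ 0
  dist-from-pendant {ℓ} {h} ℓ-pendant ℓ↛h = dist-from-source no-arc
    where
    no-arc : ∀ z → arc D ℓ z ≡ false
    no-arc z with arc D ℓ z in ℓ→z
    ... | false = refl
    ... | true with refl ← Pendant.from ℓ-pendant (arc⊆ D ℓ z ℓ→z) = trans (≡.sym ℓ→z) ℓ↛h

  dist-to-pendant : ∀ {ℓ h u d} → Pendant H ℓ h → arc D h ℓ ≡ false → IsDist D u ℓ d → d ≡ 0
  dist-to-pendant {ℓ} {h} ℓ-pendant h↛ℓ = dist-to-sink no-arc
    where
    no-arc : ∀ z → arc D z ℓ ≡ false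
    no-arc z with arc D z ℓ in z→ℓ
    ... | false = refl
    ... | true with refl ← Pendant.to ℓ-pendant (arc⊆ D z ℓ z→ℓ) = trans (≡.sym z→ℓ) h↛ℓ

  -- A walk between two pendant vertices leaves the first towards its hub and enters the second from its hub.
  dist-between-pendants : ∀ {ℓ h ℓ′ h′ d} c → Pendant H ℓ h → Pendant H ℓ′ h′ → IsDist D ℓ ℓ′ d →
                          (arc D ℓ h ≡ true → arc D h′ ℓ′ ≡ true → d ≤ c) →
                          d ≤ c * (𝟙 (arc D ℓ h) * 𝟙 (arc D h′ ℓ′))
  dist-between-pendants {ℓ} {h} {ℓ′} {h′} c ℓ-pendant ℓ′-pendant δ bound with arc D ℓ h in ℓ→h | arc D h′ ℓ′ in h′→ℓ′
  ... | false | _     = ≤-reflexive (trans (dist-from-pendant ℓ-pendant ℓ→h δ) (≡.sym (*-zeroʳ c)))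
  ... | true  | false = ≤-reflexive (trans (dist-to-pendant ℓ′-pendant h′→ℓ′ δ) (≡.sym (*-zeroʳ c)))
  ... | true  | true  = subst (_ ≤_) (≡.sym (*-identityʳ c)) (bound refl refl)

  𝟙-arc+𝟙-arc : ∀ {u v} → edge H u v ≡ true → 𝟙 (arc D u v) + 𝟙 (arc D v u) ≡ 1
  𝟙-arc+𝟙-arc {u} {v} e with total D u v e
  ... | inj₁ u→v rewrite u→v | antisym D u v u→v = refl
  ... | inj₂ v→u rewrite v→u | antisym D v u v→u = refl

module FiniteWalks {H : FinGraph} (D : Orientation H) (_≟ᵛ_ : DecidableEquality (V H))
                   (complete : ∀ v → v ∈ verts H) where

  open Walks D
  open import Data.List.Membership.DecPropositional _≟ᵛ_ using (_∈?_)

  ShorterPath : V H → V H → ℕ → Set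
  ShorterPath u v k = ∃ λ l → l ≤ k × Path u v l

  path-from : ∀ {x u v k} (w : DWalk D x v k) → Unique (vertices w) → u ∈ vertices w → ShorterPath u v k
  path-from (nil _)      uw       (here refl) = 0 , z≤n , nil _ , uw
  path-from (step e w)   uw       (here refl) = _ , ≤-refl , step e w , uw
  path-from (step _ w)   (_ ∷ uw) (there u∈)  with l , l≤k , p ← path-from w uw u∈ = l , m≤n⇒m≤1+n l≤k , p

  to-path : ∀ {u v k} → DWalk D u v k → ShorterPath u v k
  to-path (nil u) = 0 , z≤n , nil u , [] ∷ []
  to-path (step {u} e w) with l , l≤k , p , up ← to-path w with u ∈? vertices p
  ... | yes u∈ with l′ , l′≤l , q ← path-from p up u∈ = l′ , m≤n⇒m≤1+n (≤-trans l′≤l l≤k) , q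
  ... | no  u∉ = suc l , s≤s l≤k , step e p , ¬Any⇒All¬ _ u∉ ∷ up

  path-length< : ∀ {u v k} → Path u v k → k < length (verts H)
  path-length< (w , uw) = subst (_≤ length (verts H)) (length-vertices w) (unique⊆⇒length≤ uw λ {z} _ → complete z)

  walk? : ∀ k u v → Dec (DWalk D u v k)
  walk? zero    u v = Dec.map′ (λ { refl → nil u }) (λ { (nil _) → refl }) (u ≟ᵛ v)
  walk? (suc k) u v = Dec.map′ first-step→walk walk→first-step
                        (Any.any? (λ w → (arc D u w Data.Bool.≟ true) ×-dec walk? k w v) (verts H))
    where
    first-step→walk : Any (λ w → arc D u w ≡ true × DWalk D w v k) (verts H) → DWalk D u v (suc k)
    first-step→walk p with _ , e , w ← satisfied p = step e w
    walk→first-step : DWalk D u v (suc k) → Any (λ w → arc D u w ≡ true × DWalk D w v k) (verts H)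
    walk→first-step (step e w) = lose (complete _) (e , w)

  distance : ∀ u v → ∃ (IsDist D u v)
  distance u v with least-below (λ k → walk? k u v) (length (verts H))
  ... | inj₁ (k , _ , w , below) = k , inj₁ (w , shortest)
    where
    shortest : ∀ l → DWalk D u v l → k ≤ l
    shortest l w′ with l′ , l′≤l , p , _ ← to-path w′ = ≤-trans (≮⇒≥ λ l′<k → below l′<k p) l′≤l
  ... | inj₂ none = 0 , inj₂ (unreachable , refl)
    where
    unreachable : ¬ u ⇝ v
    unreachable (_ , w) with _ , _ , p ← to-path w = none (path-length< p) (proj₁ p)

  dist-path : ∀ {u v d} → IsDist D u v d → d ≡ 0 ⊎ Path u v d
  dist-path (inj₂ (_ , d≡0))       = inj₁ d≡0
  dist-path (inj₁ (w , shortest)) with l , l≤d , p , up ← to-path w =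
    inj₂ (subst (Path _ _) (≤-antisym l≤d (shortest l p)) (p , up))

module _ {H : FinGraph} (edge-sym : ∀ u v → edge H u v ≡ true → edge H v u ≡ true) where

  opposite : Orientation H → Orientation H
  opposite D = record
    { arc     = λ u v → arc D v u
    ; arc⊆    = λ u v v→u → edge-sym v u (arc⊆ D v u v→u)
    ; total   = λ u v e → total D v u (edge-sym u v e)
    ; antisym = λ u v v→u → antisym D v u v→u
    }

  module _ (D : Orientation H) where
    private
      module W  = Walks D
      module Wᵒ = Walks (opposite D)

    reverse-walk : ∀ {u v k} → DWalk D u v k → DWalk (opposite D) v u k
    reverse-walk (nil u)    = nil u
    reverse-walk (step e w) = Wᵒ.snoc (reverse-walk w) e

    vertices-reverse : ∀ {u v k} (w : DWalk D u v k) → Wᵒ.vertices (reverse-walk w) ≡ reverse (W.vertices w)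
    vertices-reverse (nil u)        = refl
    vertices-reverse (step {u} e w) = begin
      Wᵒ.vertices (Wᵒ.snoc (reverse-walk w) e) ≡⟨ Wᵒ.vertices-snoc (reverse-walk w) e ⟩
      Wᵒ.vertices (reverse-walk w) ∷ʳ u        ≡⟨ cong (_∷ʳ u) (vertices-reverse w) ⟩
      reverse (W.vertices w) ∷ʳ u              ≡⟨ unfold-reverse u (W.vertices w) ⟨
      reverse (u ∷ W.vertices w)               ∎
      where open ≡.≡-Reasoning

    reverse-path : ∀ {u v k} → W.Path u v k → Wᵒ.Path v u k
    reverse-path (w , uw) = reverse-walk w , subst Unique (≡.sym (vertices-reverse w)) (unique-reverse uw)

-- Edges are oriented down the rank when the ranks differ by one and up otherwise,
-- so the rank drops by at most one along every arc.
module RankOrientation {H : FinGraph} (edge-sym : ∀ u v → edge H u v ≡ true → edge H v u ≡ true)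
                       (rank : V H → ℕ) (rank-separates : ∀ u v → edge H u v ≡ true → rank u ≢ rank v) where

  private
    arc′ : V H → V H → Bool
    arc′ u v = edge H u v ∧ does (RankStep? (rank u) (rank v))

    arc′-intro : ∀ {u v} → edge H u v ≡ true → RankStep (rank u) (rank v) → arc′ u v ≡ true
    arc′-intro {u} {v} e s rewrite e = dec-true (RankStep? (rank u) (rank v)) s

    arc′-step : ∀ {u v} → arc′ u v ≡ true → RankStep (rank u) (rank v)
    arc′-step {u} {v} e = witness (RankStep? (rank u) (rank v)) (∧-conicalʳ (edge H u v) _ e)
      where
      witness : ∀ {P : Set} (p? : Dec P) → does p? ≡ true → P
      witness (yes p) _ = p

  orientation : Orientation H
  orientation = record
    { arc     = arc′
    ; arc⊆    = λ u v e → ∧-conicalˡ (edge H u v) _ e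
    ; total   = λ u v e → Data.Sum.map (arc′-intro e) (arc′-intro (edge-sym u v e)) (RankStep-connex (rank-separates u v e))
    ; antisym = λ u v e → trans (cong (edge H v u ∧_) (dec-false (RankStep? (rank v) (rank u)) (RankStep-asym (arc′-step e))))
                                (∧-zeroʳ (edge H v u))
    }

  arc-intro : ∀ u v → edge H u v ≡ true → rank u ≡ suc (rank v) → arc orientation u v ≡ true
  arc-intro _ _ e r = arc′-intro e (inj₁ r)

  rank-walk : ∀ {u v k} → DWalk orientation u v k → rank u ≤ k + rank v
  rank-walk (nil _)    = ≤-refl
  rank-walk (step e w) = ≤-trans (RankStep⇒≤suc (arc′-step e)) (s≤s (rank-walk w))

module _ {n : ℕ} {G : Graph n} where

  hwalk-head∈ : ∀ {x ws y} → HWalk G x ws y → x ∈ ws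
  hwalk-head∈ (single _) = here refl
  hwalk-head∈ (cons _ _) = here refl

  hwalk-last∈ : ∀ {x ws y} → HWalk G x ws y → y ∈ ws
  hwalk-last∈ (single _) = here refl
  hwalk-last∈ (cons _ w) = there (hwalk-last∈ w)

  after-head : ∀ {x ws y} → HWalk G x ws y → suc (after _≟_ x ws) ≡ length ws
  after-head (single x)                 = cong suc (after-here _≟_ x [])
  after-head (cons {a = x} {xs = ws} _ _) = cong suc (after-here _≟_ x ws)

  after-last : ∀ {x ws y} → HWalk G x ws y → Unique ws → after _≟_ y ws ≡ 0
  after-last (single x) _ = after-here _≟_ x []
  after-last {y = y} (cons {a = x} {xs = ws} _ w) (x∉ws ∷ uws) = trans (after-there _≟_ ws y≢x) (after-last w uws)
    where
    y≢x : y ≢ x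
    y≢x refl = All.lookup x∉ws (hwalk-last∈ w) refl

-- The rows of a₀ and of the leaves aᵢ when the orientation follows a Hamiltonian path.
wienerFloor : ℕ → ℕ
wienerFloor n = n ^ 3 * (2 + n) + n ^ 3 * (1 + ((2 + n) + n ^ 3 * (3 + n)))

-- n + 2 full rows, 2n³ leaf rows outside the leaves, and the leaf-to-leaf distances.
wienerCap : ℕ → ℕ
wienerCap n = (2 + n) * ((2 + n + 2 * n ^ 3) * (3 + n)) + 2 * n ^ 3 * ((2 + n) * (3 + n)) + (2 + n) * (n ^ 3 * n ^ 3)

32[2+n]≤n³ : ∀ k → 32 * (2 + (8 + k)) ≤ (8 + k) ^ 3
32[2+n]≤n³ k = ≤-trans (m≤m+n _ _) (≤-reflexive (≡.sym (expand k)))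
  where
  expand : ∀ k → (8 + k) ^ 3 ≡ 32 * (2 + (8 + k)) + (192 + 160 * k + 24 * (k * k) + k * (k * k))
  expand = solve 1 (λ k → (con 8 :+ k) :^ 3
                       := con 32 :* (con 2 :+ (con 8 :+ k)) :+ (con 192 :+ con 160 :* k :+ con 24 :* (k :* k) :+ k :* (k :* k))) refl

129[2+n][3+n]≤32n³ : ∀ k → 129 * ((2 + (8 + k)) * (3 + (8 + k))) ≤ 32 * (8 + k) ^ 3
129[2+n][3+n]≤32n³ k = ≤-trans (m≤m+n _ _) (≤-reflexive (≡.sym (expand k)))
  where
  expand : ∀ k → 32 * (8 + k) ^ 3 ≡ 129 * ((2 + (8 + k)) * (3 + (8 + k))) + (2194 + 3435 * k + 639 * (k * k) + 32 * (k * (k * k)))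
  expand = solve 1 (λ k → con 32 :* (con 8 :+ k) :^ 3
                       := con 129 :* ((con 2 :+ (con 8 :+ k)) :* (con 3 :+ (con 8 :+ k)))
                          :+ (con 2194 :+ con 3435 :* k :+ con 639 :* (k :* k) :+ con 32 :* (k :* (k :* k)))) refl

M≤wienerFloor : ∀ k → M (8 + k) ≤ wienerFloor (8 + k)
M≤wienerFloor k = +-cancelʳ-≤ (n + 1) (M n) (wienerFloor n) (begin
  M n + (n + 1)           ≤⟨ +-monoʳ-≤ (M n) n+1≤n³ ⟩
  M n + n ^ 3             ≡⟨ excess n ⟨
  wienerFloor n + (n + 1) ∎)
  where
  open ≤-Reasoning
  n = 8 + k
  n+1≤n³ : n + 1 ≤ n ^ 3
  n+1≤n³ = ≤-trans (≤-trans (≤-reflexive (+-comm n 1)) (n≤1+n (1 + n))) (≤-trans (m≤m+n (2 + n) _) (32[2+n]≤n³ k))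
  excess : ∀ n → wienerFloor n + (n + 1) ≡ M n + n ^ 3
  excess = solve 1 (λ n → n :^ 3 :* (con 2 :+ n) :+ n :^ 3 :* (con 1 :+ ((con 2 :+ n) :+ n :^ 3 :* (con 3 :+ n))) :+ (n :+ con 1)
                      := n :^ 7 :+ con 3 :* n :^ 6 :+ con 2 :* n :^ 4 :+ con 4 :* n :^ 3 :+ n :+ con 1 :+ n :^ 3) refl

[2+n][3+n][2+n+4m]≤m² : ∀ n m → 32 * (2 + n) ≤ m → 129 * ((2 + n) * (3 + n)) ≤ 32 * m →
                        (2 + n) * (3 + n) * (2 + n + 4 * m) ≤ m * m
[2+n][3+n][2+n+4m]≤m² n m 32[2+n]≤m 129[2+n][3+n]≤32m = *-cancelˡ-≤ 32 (begin
  32 * ((2 + n) * (3 + n) * (2 + n + 4 * m))     ≡⟨ e₁ n m ⟩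
  (2 + n) * (3 + n) * (32 * (2 + n) + 128 * m)   ≤⟨ *-monoʳ-≤ ((2 + n) * (3 + n)) (+-monoˡ-≤ (128 * m) 32[2+n]≤m) ⟩
  (2 + n) * (3 + n) * (m + 128 * m)              ≡⟨ e₂ n m ⟩
  m * (129 * ((2 + n) * (3 + n)))                ≤⟨ *-monoʳ-≤ m 129[2+n][3+n]≤32m ⟩
  m * (32 * m)                                   ≡⟨ e₃ m ⟩
  32 * (m * m)                                   ∎)
  where
  open ≤-Reasoning
  e₁ : ∀ n m → 32 * ((2 + n) * (3 + n) * (2 + n + 4 * m)) ≡ (2 + n) * (3 + n) * (32 * (2 + n) + 128 * m)
  e₁ = solve-∀
  e₂ : ∀ n m → (2 + n) * (3 + n) * (m + 128 * m) ≡ m * (129 * ((2 + n) * (3 + n)))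
  e₂ = solve-∀
  e₃ : ∀ m → m * (32 * m) ≡ 32 * (m * m)
  e₃ = solve-∀

wienerCap<M : ∀ k → wienerCap (8 + k) < M (8 + k)
wienerCap<M k = +-cancelʳ-≤ (n ^ 3 * n ^ 3) (suc (wienerCap n)) (M n) (begin
  suc (wienerCap n + n ^ 3 * n ^ 3)                                      ≤⟨ s≤s (+-monoʳ-≤ (wienerCap n) (m≤m+n _ _)) ⟩
  suc (wienerCap n + (n ^ 3 * n ^ 3 + (2 * n * n ^ 3 + 4 * n ^ 3 + n))) ≡⟨ excess n ⟨
  M n + (2 + n) * (3 + n) * (2 + n + 4 * n ^ 3)                          ≤⟨ +-monoʳ-≤ (M n) leaf-term≤ ⟩
  M n + n ^ 3 * n ^ 3                                                    ∎)
  where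
  open ≤-Reasoning
  n = 8 + k
  leaf-term≤ = [2+n][3+n][2+n+4m]≤m² n (n ^ 3) (32[2+n]≤n³ k) (129[2+n][3+n]≤32n³ k)
  excess : ∀ n → M n + (2 + n) * (3 + n) * (2 + n + 4 * n ^ 3) ≡ suc (wienerCap n + (n ^ 3 * n ^ 3 + (2 * n * n ^ 3 + 4 * n ^ 3 + n)))
  excess = solve 1 (λ n →
      n :^ 7 :+ con 3 :* n :^ 6 :+ con 2 :* n :^ 4 :+ con 4 :* n :^ 3 :+ n :+ con 1 :+ (con 2 :+ n) :* (con 3 :+ n) :* (con 2 :+ n :+ con 4 :* n :^ 3)
    := con 1 :+ ((con 2 :+ n) :* ((con 2 :+ n :+ con 2 :* n :^ 3) :* (con 3 :+ n)) :+ con 2 :* n :^ 3 :* ((con 2 :+ n) :* (con 3 :+ n))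
                 :+ (con 2 :+ n) :* (n :^ 3 :* n :^ 3) :+ (n :^ 3 :* n :^ 3 :+ (con 2 :* n :* n :^ 3 :+ con 4 :* n :^ 3 :+ n)))) refl

module Ext {n : ℕ} (G : Graph n) (a b : Fin n) where

  H : FinGraph
  H = ext G a b

  m : ℕ
  m = n ^ 3

  _≟ᵛ_ : DecidableEquality (ExtV n)
  old x ≟ᵛ old y = Dec.map′ (cong old) (λ { refl → refl }) (x ≟ y)
  aV i  ≟ᵛ aV j  = Dec.map′ (cong aV)  (λ { refl → refl }) (i ≟ j)
  bV i  ≟ᵛ bV j  = Dec.map′ (cong bV)  (λ { refl → refl }) (i ≟ j)
  old _ ≟ᵛ aV _  = no λ ()
  old _ ≟ᵛ bV _  = no λ ()
  aV _  ≟ᵛ old _ = no λ ()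
  aV _  ≟ᵛ bV _  = no λ ()
  bV _  ≟ᵛ old _ = no λ ()
  bV _  ≟ᵛ aV _  = no λ ()

  complete : ∀ v → v ∈ verts H
  complete (old x) = ∈-++⁺ˡ (∈-map⁺ old (∈-allFin x))
  complete (aV i)  = ∈-++⁺ʳ (map old (allFin n)) (∈-++⁺ˡ (∈-map⁺ aV (∈-allFin i)))
  complete (bV i)  = ∈-++⁺ʳ (map old (allFin n)) (∈-++⁺ʳ (map aV (allFin (suc m))) (∈-map⁺ bV (∈-allFin i)))

  data ExtEdge : ExtV n → ExtV n → Set where
    old-old : ∀ {x y} → adj G x y ≡ true → ExtEdge (old x) (old y)
    a-a₀    : ExtEdge (old a) (aV zero)
    a₀-a    : ExtEdge (aV zero) (old a)
    b-b₀    : ExtEdge (old b) (bV zero)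
    b₀-b    : ExtEdge (bV zero) (old b)
    a₀-aᵢ   : ∀ i → ExtEdge (aV zero) (aV (suc i))
    aᵢ-a₀   : ∀ i → ExtEdge (aV (suc i)) (aV zero)
    b₀-bᵢ   : ∀ i → ExtEdge (bV zero) (bV (suc i))
    bᵢ-b₀   : ∀ i → ExtEdge (bV (suc i)) (bV zero)

  edge-view : ∀ {u v} → extEdge G a b u v ≡ true → ExtEdge u v
  edge-view {old x}      {old y}      e = old-old e
  edge-view {old x}      {aV zero}    e with x ≟ a
  ... | yes refl = a-a₀
  edge-view {aV zero}    {old x}      e with x ≟ a
  ... | yes refl = a₀-a
  edge-view {old x}      {bV zero}    e with x ≟ b
  ... | yes refl = b-b₀
  edge-view {bV zero}    {old x}      e with x ≟ b
  ... | yes refl = b₀-b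
  edge-view {aV zero}    {aV (suc i)} _ = a₀-aᵢ i
  edge-view {aV (suc i)} {aV zero}    _ = aᵢ-a₀ i
  edge-view {bV zero}    {bV (suc i)} _ = b₀-bᵢ i
  edge-view {bV (suc i)} {bV zero}    _ = bᵢ-b₀ i
  edge-view {old _}      {aV (suc _)} ()
  edge-view {old _}      {bV (suc _)} ()
  edge-view {aV zero}    {aV zero}    ()
  edge-view {aV zero}    {bV _}       ()
  edge-view {aV (suc _)} {old _}      ()
  edge-view {aV (suc _)} {aV (suc _)} ()
  edge-view {aV (suc _)} {bV _}       ()
  edge-view {bV zero}    {aV _}       ()
  edge-view {bV zero}    {bV zero}    ()
  edge-view {bV (suc _)} {old _}      ()
  edge-view {bV (suc _)} {aV _}       ()
  edge-view {bV (suc _)} {bV (suc _)} ()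

  ⌊x≟x⌋ : ∀ (x : Fin n) → ⌊ x ≟ x ⌋ ≡ true
  ⌊x≟x⌋ x = trans (isYes≗does (x ≟ x)) (dec-true (x ≟ x) refl)

  view-edge : ∀ {u v} → ExtEdge u v → extEdge G a b u v ≡ true
  view-edge (old-old e) = e
  view-edge a-a₀        = ⌊x≟x⌋ a
  view-edge a₀-a        = ⌊x≟x⌋ a
  view-edge b-b₀        = ⌊x≟x⌋ b
  view-edge b₀-b        = ⌊x≟x⌋ b
  view-edge (a₀-aᵢ _)   = refl
  view-edge (aᵢ-a₀ _)   = refl
  view-edge (b₀-bᵢ _)   = refl
  view-edge (bᵢ-b₀ _)   = refl

  ExtEdge-sym : ∀ {u v} → ExtEdge u v → ExtEdge v u
  ExtEdge-sym (old-old {x} {y} e) = old-old (trans (Graph.sym G y x) e)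
  ExtEdge-sym a-a₀      = a₀-a
  ExtEdge-sym a₀-a      = a-a₀
  ExtEdge-sym b-b₀      = b₀-b
  ExtEdge-sym b₀-b      = b-b₀
  ExtEdge-sym (a₀-aᵢ i) = aᵢ-a₀ i
  ExtEdge-sym (aᵢ-a₀ i) = a₀-aᵢ i
  ExtEdge-sym (b₀-bᵢ i) = bᵢ-b₀ i
  ExtEdge-sym (bᵢ-b₀ i) = b₀-bᵢ i

  ext-edge-sym : ∀ u v → extEdge G a b u v ≡ true → extEdge G a b v u ≡ true
  ext-edge-sym u v e = view-edge (ExtEdge-sym (edge-view {u} {v} e))

  aᵢ-pendant : ∀ i → Pendant H (aV (suc i)) (aV zero)
  aᵢ-pendant i = record { from = from ; to = to }
    where
    from : ∀ {u} → extEdge G a b (aV (suc i)) u ≡ true → u ≡ aV zero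
    from {u} e with aᵢ-a₀ _ ← edge-view {aV (suc i)} {u} e = refl
    to : ∀ {u} → extEdge G a b u (aV (suc i)) ≡ true → u ≡ aV zero
    to {u} e with a₀-aᵢ _ ← edge-view {u} {aV (suc i)} e = refl

  bᵢ-pendant : ∀ i → Pendant H (bV (suc i)) (bV zero)
  bᵢ-pendant i = record { from = from ; to = to }
    where
    from : ∀ {u} → extEdge G a b (bV (suc i)) u ≡ true → u ≡ bV zero
    from {u} e with bᵢ-b₀ _ ← edge-view {bV (suc i)} {u} e = refl
    to : ∀ {u} → extEdge G a b u (bV (suc i)) ≡ true → u ≡ bV zero
    to {u} e with b₀-bᵢ _ ← edge-view {u} {bV (suc i)} e = refl

  nonLeaves : List (ExtV n)
  nonLeaves = aV zero ∷ bV zero ∷ map old (allFin n)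

  length-nonLeaves : length nonLeaves ≡ 2 + n
  length-nonLeaves = cong (2 +_) (trans (length-map old (allFin n)) (length-allFin n))

  sum-verts : ∀ (g : ExtV n → ℕ) → sum (map g (verts H)) ≡
              sum (map (g ∘ old) (allFin n)) + ((g (aV zero) + sum (map (g ∘ aV ∘ suc) (allFin m)))
                                               + (g (bV zero) + sum (map (g ∘ bV ∘ suc) (allFin m))))
  sum-verts g = trans (sum-map-++ g (map old (allFin n)) _)
                  (cong₂ _+_ (sum-map-map g old (allFin n)) (trans (sum-map-++ g (map aV (allFin (suc m))) _)
                                                               (cong₂ _+_ (side aV) (side bV))))
    where
    side : (f : Fin (suc m) → ExtV n) → sum (map g (map f (allFin (suc m)))) ≡ g (f zero) + sum (map (g ∘ f ∘ suc) (allFin m))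
    side f = trans (sum-map-map g f (allFin (suc m))) (cong sum (map-allFin-suc (g ∘ f)))

  sum-verts-≤ : ∀ {g : ExtV n → ℕ} {o h L h′ L′} → (∀ x → g (old x) ≤ o) →
                g (aV zero) ≤ h  → sum (map (g ∘ aV ∘ suc) (allFin m)) ≤ L →
                g (bV zero) ≤ h′ → sum (map (g ∘ bV ∘ suc) (allFin m)) ≤ L′ →
                sum (map g (verts H)) ≤ n * o + ((h + L) + (h′ + L′))
  sum-verts-≤ {g} old≤ a₀≤ aᵢ≤ b₀≤ bᵢ≤ =
    ≤-trans (≤-reflexive (sum-verts g)) (+-mono-≤ (sum-allFin≤const old≤) (+-mono-≤ (+-mono-≤ a₀≤ aᵢ≤) (+-mono-≤ b₀≤ bᵢ≤)))

  a-side≤ : ∀ (g : ExtV n → ℕ) → g (aV zero) + sum (map (g ∘ aV ∘ suc) (allFin m)) ≤ sum (map g (verts H))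
  a-side≤ g = ≤-trans (≤-trans (m≤m+n _ (g (bV zero) + sum (map (g ∘ bV ∘ suc) (allFin m))))
                              (m≤n+m _ (sum (map (g ∘ old) (allFin n)))))
                     (≤-reflexive (≡.sym (sum-verts g)))

  hubs+b-leaves≤ : ∀ (g : ExtV n → ℕ) → g (aV zero) + (g (bV zero) + sum (map (g ∘ bV ∘ suc) (allFin m))) ≤ sum (map g (verts H))
  hubs+b-leaves≤ g = ≤-trans (≤-trans (+-monoˡ-≤ (g (bV zero) + sum (map (g ∘ bV ∘ suc) (allFin m)))
                                                 (m≤m+n (g (aV zero)) (sum (map (g ∘ aV ∘ suc) (allFin m)))))
                                     (m≤n+m _ (sum (map (g ∘ old) (allFin n)))))
                            (≤-reflexive (≡.sym (sum-verts g)))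

  b-leaves≤ : ∀ (g : ExtV n → ℕ) → sum (map (g ∘ bV ∘ suc) (allFin m)) ≤ sum (map g (verts H))
  b-leaves≤ g = ≤-trans (≤-trans (m≤n+m _ (g (bV zero))) (m≤n+m _ (g (aV zero)))) (hubs+b-leaves≤ g)

  module _ (D : Orientation H) where

    open Walks D
    open FiniteWalks D _≟ᵛ_ complete

    arc-view : ∀ {u v} → arc D u v ≡ true → ExtEdge u v
    arc-view {u} {v} e = edge-view {u} {v} (arc⊆ D u v e)

    -- Inner vertices of a path are distinct and, having two distinct neighbours, are not leaves.
    path-length≤ : ∀ {u v k} → Path u v k → k ≤ 3 + n
    path-length≤ (nil _ , _) = z≤n
    path-length≤ (step {k = k} e w , uvw@(_ ∷ uw)) = s≤s (begin
      k                ≡⟨ length-inner w ⟨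
      length (inner w) ≤⟨ unique⊆⇒length≤ (unique-inner w uw) inner⊆nonLeaves ⟩
      length nonLeaves ≡⟨ length-nonLeaves ⟩
      2 + n            ∎)
      where
      open ≤-Reasoning
      inner⊆nonLeaves : inner w ⊆ nonLeaves
      inner⊆nonLeaves {old x}      _  = there (there (∈-map⁺ old (∈-allFin x)))
      inner⊆nonLeaves {aV zero}    _  = here refl
      inner⊆nonLeaves {bV zero}    _  = there (here refl)
      inner⊆nonLeaves {aV (suc i)} ℓ∈ = contradiction ℓ∈ (pendant-not-inner (aᵢ-pendant i) e w uvw)
      inner⊆nonLeaves {bV (suc i)} ℓ∈ = contradiction ℓ∈ (pendant-not-inner (bᵢ-pendant i) e w uvw)

    dist≤3+n : ∀ {u v d} → IsDist D u v d → d ≤ 3 + n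
    dist≤3+n δ with dist-path δ
    ... | inj₁ refl = z≤n
    ... | inj₂ p    = path-length≤ p

    project : ∀ {x j k} (q : DWalk D (old x) (bV (suc j)) k) → Unique (vertices q) → All (aV zero ≢_) (vertices q) →
            ∃ λ ps → HWalk G x ps b × vertices q ≡ map old ps ++ bV zero ∷ bV (suc j) ∷ []
    project (step e q) uq a₀∉ with arc-view e
    project (step e q) (_ ∷ uq) (_ ∷ a₀∉) | old-old xy with ps , w , eq ← project q uq a₀∉ = _ ∷ ps , cons xy w , cong (_ ∷_) eq
    project (step e q) _ (_ ∷ a₀∉) | a-a₀ = contradiction refl (All.lookup a₀∉ (head∈ q))
    project (step e (step e′ q)) (b∉ ∷ b₀∉ ∷ _) _ | b-b₀ with arc-view e′
    ... | b₀-b = contradiction refl (All.lookup b∉ (there (head∈ q)))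
    ... | b₀-bᵢ _ with q
    ...   | nil _ = b ∷ [] , single b , refl
    ...   | step e″ q′ with bᵢ-b₀ _ ← arc-view e″ = contradiction refl (All.lookup b₀∉ (there (head∈ q′)))

    long-path⇒HamPath : ∀ {i j k} → Path (aV (suc i)) (bV (suc j)) k → 3 + n ≤ k → HamPath G a b
    long-path⇒HamPath (step e₁ w , _) _ with arc-view e₁
    long-path⇒HamPath (step e₁ (step e₂ q) , _ ∷ a₀∉ ∷ uq) _ | aᵢ-a₀ _ with arc-view e₂
    ... | a₀-aᵢ _ with q
    ...   | step e₃ q′ with aᵢ-a₀ _ ← arc-view e₃ = contradiction refl (All.lookup a₀∉ (there (head∈ q′)))
    long-path⇒HamPath (step e₁ (step e₂ q) , _ ∷ a₀∉ ∷ uq) 3+n≤k | aᵢ-a₀ _ | a₀-a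
      with ps , w , eq ← project q uq a₀∉ =
      ps , w , unique-ps , λ v → unique-length⇒⊇ _≟_ unique-ps (λ {v} _ → ∈-allFin v) |allFin|≤|ps| (∈-allFin v)
      where
      unique-ps : Unique ps
      unique-ps = map⁻ (unique-++⁻ˡ (map old ps) (subst Unique eq uq))
      |allFin|≤|ps| : length (allFin n) ≤ length ps
      |allFin|≤|ps| = subst (_≤ length ps) (≡.sym (length-allFin n)) (+-cancelʳ-≤ 2 n (length ps) (begin
        n + 2               ≡⟨ +-comm n 2 ⟩
        2 + n               ≤⟨ ≤-trans (≤-pred 3+n≤k) (≤-reflexive (≡.sym (length-vertices q))) ⟩
        length (vertices q) ≡⟨ cong length eq ⟩
        length (map old ps ++ bV zero ∷ bV (suc _) ∷ []) ≡⟨ length-++ (map old ps) ⟩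
        length (map old ps) + 2 ≡⟨ cong (_+ 2) (length-map old ps) ⟩
        length ps + 2       ∎))
        where open ≤-Reasoning

    long-dist⇒HamPath : ∀ {i j d} → IsDist D (aV (suc i)) (bV (suc j)) d → 3 + n ≤ d → HamPath G a b
    long-dist⇒HamPath δ 3+n≤d with dist-path δ
    ... | inj₁ refl = contradiction 3+n≤d λ ()
    ... | inj₂ p    = long-path⇒HamPath p 3+n≤d

  long-reverse-dist⇒HamPath : ∀ (D : Orientation H) {i j d} → IsDist D (bV (suc j)) (aV (suc i)) d → 3 + n ≤ d → HamPath G a b
  long-reverse-dist⇒HamPath D δ 3+n≤d with FiniteWalks.dist-path {H} D _≟ᵛ_ complete δ
  ... | inj₁ refl = contradiction 3+n≤d λ ()
  ... | inj₂ p    = long-path⇒HamPath (opposite ext-edge-sym D) (reverse-path ext-edge-sym D p) 3+n≤d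

  module Forward {xs : List (Fin n)} (ham : HWalk G a xs b) (unique : Unique xs) (covers : ∀ v → v ∈ xs) where

    ρ : Fin n → ℕ
    ρ v = after _≟_ v xs

    -- The distance to the end of the directed path aᵢ a₀ a … b b₀ bⱼ.
    rank : ExtV n → ℕ
    rank (old v)      = 2 + ρ v
    rank (aV zero)    = 3 + ρ a
    rank (aV (suc _)) = 4 + ρ a
    rank (bV zero)    = 1
    rank (bV (suc _)) = 0

    rank-separates : ∀ {u v} → ExtEdge u v → rank u ≢ rank v
    rank-separates (old-old {x} {y} xy) eq
      with refl ← after-injective _≟_ (covers x) (covers y) (suc-injective (suc-injective eq))
      = contradiction (trans (≡.sym xy) (irrefl G x)) λ ()
    rank-separates a-a₀      eq = 1+n≢n (≡.sym eq)
    rank-separates a₀-a      eq = 1+n≢n eq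
    rank-separates b-b₀      ()
    rank-separates b₀-b      ()
    rank-separates (a₀-aᵢ _) eq = 1+n≢n (≡.sym eq)
    rank-separates (aᵢ-a₀ _) eq = 1+n≢n eq
    rank-separates (b₀-bᵢ _) ()
    rank-separates (bᵢ-b₀ _) ()

    open RankOrientation {H} ext-edge-sym rank (λ u v e → rank-separates (edge-view {u} {v} e)) public
    open Walks orientation
    open FiniteWalks orientation _≟ᵛ_ complete

    -- ws is a suffix of the Hamiltonian path, and ρ may be measured within it.
    lift : ∀ {x ws y} → HWalk G x ws y → Unique ws → (∀ {v} → v ∈ ws → ρ v ≡ after _≟_ v ws) → old x ⇝ old y
    lift (single x) _ _ = 0 , nil (old x)
    lift (cons {a = x} {x = x′} {xs = ws} xx′ w) (x∉ws ∷ uws) agree = arc-intro (old x) (old x′) xx′ (cong (2 +_) ρx≡1+ρx′) ◅ lift w uws agree′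
      where
      agree′ : ∀ {v} → v ∈ ws → ρ v ≡ after _≟_ v ws
      agree′ v∈ = trans (agree (there v∈)) (after-there _≟_ ws λ { refl → All.lookup x∉ws v∈ refl })
      ρx≡1+ρx′ : ρ x ≡ suc (ρ x′)
      ρx≡1+ρx′ = begin
        ρ x                   ≡⟨ agree (here refl) ⟩
        after _≟_ x (x ∷ ws)  ≡⟨ after-here _≟_ x ws ⟩
        length ws             ≡⟨ after-head w ⟨
        suc (after _≟_ x′ ws) ≡⟨ cong suc (agree′ (hwalk-head∈ w)) ⟨
        suc (ρ x′)            ∎
        where open ≡.≡-Reasoning

    n≤1+ρa : n ≤ suc (ρ a)
    n≤1+ρa = begin
      n                 ≡⟨ length-allFin n ⟨
      length (allFin n) ≤⟨ unique⊆⇒length≤ (allFin⁺ n) (λ {v} _ → covers v) ⟩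
      length xs         ≡⟨ after-head ham ⟨
      suc (ρ a)         ∎
      where open ≤-Reasoning

    aᵢ→a₀ : ∀ i → arc orientation (aV (suc i)) (aV zero) ≡ true
    aᵢ→a₀ i = arc-intro (aV (suc i)) (aV zero) refl refl

    b₀→bⱼ : ∀ j → arc orientation (bV zero) (bV (suc j)) ≡ true
    b₀→bⱼ j = arc-intro (bV zero) (bV (suc j)) refl refl

    a₀⇝b₀ : aV zero ⇝ bV zero
    a₀⇝b₀ = arc-intro (aV zero) (old a) (view-edge a₀-a) refl ◅ lift ham unique (λ _ → refl)
          ▻ arc-intro (old b) (bV zero) (view-edge b-b₀) (cong (2 +_) (after-last ham unique))

    d : ExtV n → ExtV n → ℕ
    d u v = proj₁ (distance u v)

    δ : ∀ u v → IsDist orientation u v (d u v)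
    δ u v = proj₂ (distance u v)

    rank-dist : ∀ {u v} → u ⇝ v → rank u ≤ d u v + rank v
    rank-dist r = rank-walk (dist-walk (δ _ _) r)

    aᵢ-a₀-far : ∀ i → 1 ≤ d (aV (suc i)) (aV zero)
    aᵢ-a₀-far i = +-cancelʳ-≤ (3 + ρ a) 1 _ (rank-dist (aᵢ→a₀ i ◅ (0 , nil _)))

    aᵢ-b₀-far : ∀ i → 2 + n ≤ d (aV (suc i)) (bV zero)
    aᵢ-b₀-far i = ≤-trans (s≤s (s≤s n≤1+ρa)) (≤-pred (subst (4 + ρ a ≤_) (+-comm _ 1) (rank-dist (aᵢ→a₀ i ◅ a₀⇝b₀))))

    aᵢ-bⱼ-far : ∀ i j → 3 + n ≤ d (aV (suc i)) (bV (suc j))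
    aᵢ-bⱼ-far i j = ≤-trans (s≤s (s≤s (s≤s n≤1+ρa))) (subst (4 + ρ a ≤_) (+-identityʳ _) (rank-dist (aᵢ→a₀ i ◅ a₀⇝b₀ ▻ b₀→bⱼ j)))

    a₀-bⱼ-far : ∀ j → 2 + n ≤ d (aV zero) (bV (suc j))
    a₀-bⱼ-far j = ≤-trans (s≤s (s≤s n≤1+ρa)) (subst (3 + ρ a ≤_) (+-identityʳ _) (rank-dist (a₀⇝b₀ ▻ b₀→bⱼ j)))

    row : ExtV n → ℕ
    row u = sum (map (d u) (verts H))

    row-a₀ : m * (2 + n) ≤ row (aV zero)
    row-a₀ = ≤-trans (const≤sum-allFin a₀-bⱼ-far) (b-leaves≤ (d (aV zero)))

    row-aᵢ : ∀ i → 1 + ((2 + n) + m * (3 + n)) ≤ row (aV (suc i))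
    row-aᵢ i = ≤-trans (+-mono-≤ (aᵢ-a₀-far i) (+-mono-≤ (aᵢ-b₀-far i) (const≤sum-allFin (aᵢ-bⱼ-far i))))
                       (hubs+b-leaves≤ (d (aV (suc i))))

    wiener≥ : wienerFloor n ≤ sum (map row (verts H))
    wiener≥ = ≤-trans (+-mono-≤ row-a₀ (const≤sum-allFin row-aᵢ)) (a-side≤ row)

  forward : HamPath G a b → Σ (Orientation H) λ D → ∃[ w ] (IsWiener D w × wienerFloor n ≤ w)
  forward (_ , ham , unique , covers) =
    orientation , _ , (d , δ , refl) , subst (wienerFloor n ≤_) (≡.sym (sum-concatMap _ (verts H))) wiener≥
    where open Forward ham unique covers

  module Backward (D : Orientation H) (d : ExtV n → ExtV n → ℕ) (δ : ∀ u v → IsDist D u v (d u v)) where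

    open Walks D

    row : ExtV n → ℕ
    row u = sum (map (d u) (verts H))

    towards : ExtV n → (Fin m → ExtV n) → ℕ
    towards h leaf = sum (map (λ i → 𝟙 (arc D (leaf i) h)) (allFin m))

    away : ExtV n → (Fin m → ExtV n) → ℕ
    away h leaf = sum (map (λ i → 𝟙 (arc D h (leaf i))) (allFin m))

    towards+away : ∀ h leaf → (∀ i → edge H (leaf i) h ≡ true) → towards h leaf + away h leaf ≡ m
    towards+away h leaf e = begin
      towards h leaf + away h leaf                                          ≡⟨ sum-map-+ _ _ (allFin m) ⟨
      sum (map (λ i → 𝟙 (arc D (leaf i) h) + 𝟙 (arc D h (leaf i))) (allFin m)) ≡⟨ cong sum (map-cong (λ i → 𝟙-arc+𝟙-arc (e i)) (allFin m)) ⟩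
      sum (map (λ _ → 1) (allFin m))                                        ≡⟨ sum-map-const 1 (allFin m) ⟩
      length (allFin m) * 1                                                 ≡⟨ *-identityʳ _ ⟩
      length (allFin m)                                                     ≡⟨ length-allFin m ⟩
      m                                                                     ∎
      where open ≡.≡-Reasoning

    dist≤ : ∀ u v → d u v ≤ 3 + n
    dist≤ u v = dist≤3+n D (δ u v)

    row≤ : ∀ u → row u ≤ (2 + n + 2 * m) * (3 + n)
    row≤ u = ≤-trans (sum-verts-≤ {g = d u} (λ x → dist≤ u (old x))
                                 (dist≤ u (aV zero)) (sum-allFin≤const λ i → dist≤ u (aV (suc i)))
                                 (dist≤ u (bV zero)) (sum-allFin≤const λ i → dist≤ u (bV (suc i))))
                     (≤-reflexive (count n m))
      where
      count : ∀ n m → n * (3 + n) + ((3 + n + m * (3 + n)) + (3 + n + m * (3 + n))) ≡ (2 + n + 2 * m) * (3 + n)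
      count = solve-∀

    row-leaf : ∀ {ℓ h} cᵃ cᵇ →
      (∀ k → d ℓ (aV (suc k)) ≤ cᵃ * (𝟙 (arc D ℓ h) * 𝟙 (arc D (aV zero) (aV (suc k))))) →
      (∀ k → d ℓ (bV (suc k)) ≤ cᵇ * (𝟙 (arc D ℓ h) * 𝟙 (arc D (bV zero) (bV (suc k))))) →
      row ℓ ≤ (2 + n) * (3 + n) + (cᵃ * away (aV zero) (aV ∘ suc) + cᵇ * away (bV zero) (bV ∘ suc)) * 𝟙 (arc D ℓ h)
    row-leaf {ℓ} {h} cᵃ cᵇ toA toB =
      ≤-trans (sum-verts-≤ {g = d ℓ} (λ x → dist≤ ℓ (old x)) (dist≤ ℓ (aV zero)) (≤-trans (sum-map-mono toA (allFin m)) (≤-reflexive (scale cᵃ)))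
                                            (dist≤ ℓ (bV zero)) (≤-trans (sum-map-mono toB (allFin m)) (≤-reflexive (scale cᵇ))))
              (≤-reflexive (count n (𝟙 (arc D ℓ h)) cᵃ cᵇ _ _))
      where
      scale : ∀ c {f : Fin m → ℕ} → sum (map (λ k → c * (𝟙 (arc D ℓ h) * f k)) (allFin m)) ≡ c * (𝟙 (arc D ℓ h) * sum (map f (allFin m)))
      scale c {f} = trans (sum-map-*ˡ c _ (allFin m)) (cong (c *_) (sum-map-*ˡ (𝟙 (arc D ℓ h)) f (allFin m)))
      count : ∀ n c cᵃ cᵇ oᵃ oᵇ → n * (3 + n) + ((3 + n + cᵃ * (c * oᵃ)) + (3 + n + cᵇ * (c * oᵇ))) ≡
                                   (2 + n) * (3 + n) + (cᵃ * oᵃ + cᵇ * oᵇ) * c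
      count = solve-∀

    module _ (ab-short : ∀ i j → d (aV (suc i)) (bV (suc j)) ≤ 2 + n)
             (ba-short : ∀ j i → d (bV (suc j)) (aV (suc i)) ≤ 2 + n) where

      two-step : ∀ {ℓ h ℓ′} → arc D ℓ h ≡ true → arc D h ℓ′ ≡ true → d ℓ ℓ′ ≤ 2
      two-step ℓ→h h→ℓ′ = dist≤length (δ _ _) (step ℓ→h (step h→ℓ′ (nil _)))

      row-aᵢ : ∀ i → row (aV (suc i)) ≤ (2 + n) * (3 + n) + (2 * away (aV zero) (aV ∘ suc) + (2 + n) * away (bV zero) (bV ∘ suc))
                                                          * 𝟙 (arc D (aV (suc i)) (aV zero))
      row-aᵢ i = row-leaf 2 (2 + n)
        (λ k → dist-between-pendants 2 (aᵢ-pendant i) (aᵢ-pendant k) (δ _ _) two-step)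
        (λ k → dist-between-pendants (2 + n) (aᵢ-pendant i) (bᵢ-pendant k) (δ _ _) λ _ _ → ab-short i k)

      row-bⱼ : ∀ j → row (bV (suc j)) ≤ (2 + n) * (3 + n) + ((2 + n) * away (aV zero) (aV ∘ suc) + 2 * away (bV zero) (bV ∘ suc))
                                                          * 𝟙 (arc D (bV (suc j)) (bV zero))
      row-bⱼ j = row-leaf (2 + n) 2
        (λ k → dist-between-pendants (2 + n) (bᵢ-pendant j) (aᵢ-pendant k) (δ _ _) λ _ _ → ba-short j k)
        (λ k → dist-between-pendants 2 (bᵢ-pendant j) (bᵢ-pendant k) (δ _ _) two-step)

      wiener≤ : sum (map row (verts H)) ≤ wienerCap n
      wiener≤ = begin
        sum (map row (verts H))
          ≤⟨ sum-verts-≤ {g = row} (λ x → row≤ (old x)) (row≤ (aV zero)) (sum-allFin≤affine {K = K} {Zᵃ} row-aᵢ) (row≤ (bV zero)) (sum-allFin≤affine {K = K} {Zᵇ} row-bⱼ) ⟩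
        n * B + ((B + (m * K + Zᵃ * Xᵃ)) + (B + (m * K + Zᵇ * Xᵇ)))
          ≡⟨ assemble n B m K (Zᵃ * Xᵃ) (Zᵇ * Xᵇ) ⟩
        (2 + n) * B + 2 * m * K + (Zᵃ * Xᵃ + Zᵇ * Xᵇ)
          ≤⟨ +-monoʳ-≤ ((2 + n) * B + 2 * m * K) leaves ⟩
        wienerCap n ∎
        where
        open ≤-Reasoning
        B = (2 + n + 2 * m) * (3 + n)
        K = (2 + n) * (3 + n)
        Xᵃ = towards (aV zero) (aV ∘ suc)
        Xᵇ = towards (bV zero) (bV ∘ suc)
        Yᵃ = away (aV zero) (aV ∘ suc)
        Yᵇ = away (bV zero) (bV ∘ suc)
        Zᵃ = 2 * Yᵃ + (2 + n) * Yᵇ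
        Zᵇ = (2 + n) * Yᵃ + 2 * Yᵇ
        Xᵃ+Yᵃ≡m = towards+away (aV zero) (aV ∘ suc) λ _ → refl
        Xᵇ+Yᵇ≡m = towards+away (bV zero) (bV ∘ suc) λ _ → refl
        leaves : Zᵃ * Xᵃ + Zᵇ * Xᵇ ≤ (2 + n) * (m * m)
        leaves = subst₂ (λ p q → Zᵃ * Xᵃ + Zᵇ * Xᵇ ≤ (2 + n) * (p * q)) Xᵃ+Yᵃ≡m Xᵇ+Yᵇ≡m
                   (leaf-pairs≤ n Xᵃ Yᵃ Xᵇ Yᵇ (trans Xᵃ+Yᵃ≡m (≡.sym Xᵇ+Yᵇ≡m)))
        assemble : ∀ n B m K P Q → n * B + ((B + (m * K + P)) + (B + (m * K + Q))) ≡ (2 + n) * B + 2 * m * K + (P + Q)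
        assemble = solve-∀

  backward : (D : Orientation H) → ∃[ w ] (IsWiener D w × wienerCap n < w) → HamPath G a b
  backward D (_ , (d , δ , refl) , cap<w)
    with any? (λ i → any? (λ j → 3 + n ≤? d (aV (suc i)) (bV (suc j))))
  ... | yes (_ , _ , far) = long-dist⇒HamPath D (δ _ _) far
  ... | no ab-short with any? (λ j → any? (λ i → 3 + n ≤? d (bV (suc j)) (aV (suc i))))
  ...   | yes (_ , _ , far) = long-reverse-dist⇒HamPath D (δ _ _) far
  ...   | no ba-short = contradiction W≤cap (<⇒≱ cap<w)
    where
    open Backward D d δ
    W≤cap : sum (concatMap (λ u → map (d u) (verts H)) (verts H)) ≤ wienerCap n
    W≤cap = subst (_≤ wienerCap n) (≡.sym (sum-concatMap _ (verts H)))
              (wiener≤ (λ i j → ≤-pred (≰⇒> λ far → ab-short (i , j , far)))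
                       (λ j i → ≤-pred (≰⇒> λ far → ba-short (j , i , far))))

lemma2 : ∃[ N₀ ] ∀ (n : ℕ) → N₀ ≤ n → (G : Graph n) (a b : Fin n) →
    HamPath G a b ⇔
    (Σ (Orientation (ext G a b)) λ D → ∃[ w ] (IsWiener D w × M n ≤ w))
lemma2 = 8 , equivalence
  where
  equivalence : ∀ (n : ℕ) → 8 ≤ n → (G : Graph n) (a b : Fin n) →
                HamPath G a b ⇔ (Σ (Orientation (ext G a b)) λ D → ∃[ w ] (IsWiener D w × M n ≤ w))
  equivalence n 8≤n G a b with k , refl ← m≤n⇒∃[o]m+o≡n 8≤n = mk⇔
    (λ ham → let D , w , W , floor≤w = forward ham in D , w , W , ≤-trans (M≤wienerFloor k) floor≤w)
    (λ (D , w , W , M≤w) → backward D (w , W , <-≤-trans (wienerCap<M k) M≤w))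
    where open Ext G a b
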